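{- Let $m\ge 0$ and $n\ge 1$ be integers. (1) The number of integer solutions $(x_1,\dots,x_n)\in\mathbb Z^n$ of $|x_1|+|x_2|+\cdots+|x_n|\le m$ equals $\binom{m,n}{n,2}$. (2) For $m\ge1$, the number of integer solutions $(x_1,\dots,x_n)\in\mathbb Z^n$ of $|x_1|+|x_2|+\cdots+|x_n|=m$ equals $\binom{m-1,n}{n-1,2}$.
   Context: For a nonnegative integer $m$ and positive integers $n,q$, let $X$ be a set which is the disjoint union of $n$ "main blocks" each of size $q$ and an "additional block" of size $m$. An $(n+k)$-inset of $X$ is an $(n+k)$-element subset of $X$ that intersects every main block; their number is denoted $\binom{m,n}{k,q}$. -}

module Defs where

open import Data.Bool using (Bool; true; false; _∧_; _∨_; if_then_else_)
open import Data.Nat using (ℕ; zero; suc; _+_; _≡ᵇ_)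
open import Data.List using (List; []; _∷_; concatMap; map; length; filterᵇ)
open import Data.Product using (_×_; _,_)
open import Data.Vec using (Vec; []; _∷_; foldr)
import Data.Vec as V
open import Data.Integer using (ℤ; ∣_∣)

allVecs : {A : Set} → List A → (k : ℕ) → List (Vec A k)
allVecs xs zero    = [] ∷ []
allVecs xs (suc k) = concatMap (λ x → map (x ∷_) (allVecs xs k)) xs

countTrue : {k : ℕ} → Vec Bool k → ℕ
countTrue = foldr _ (λ b r → (if b then 1 else 0) + r) 0

nonemptyᵇ : {k : ℕ} → Vec Bool k → Bool
nonemptyᵇ = foldr _ _∨_ false

allᵇ : {A : Set} {k : ℕ} → (A → Bool) → Vec A k → Bool
allᵇ p = foldr _ (λ a r → p a ∧ r) true

-- The ground set X = (n main blocks of size q) ⊔ (additional block of size m).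
-- A subset of X is encoded by its characteristic function:
-- a vector of n vectors of length q (one per main block) together with a
-- vector of length m (the additional block).
SubsetX : (m n q : ℕ) → Set
SubsetX m n q = Vec (Vec Bool q) n × Vec Bool m



allSubsetsX : (m n q : ℕ) → List (SubsetX m n q)
allSubsetsX m n q =
  concatMap (λ bs → map (bs ,_) (allVecs (true ∷ false ∷ []) m))
            (allVecs (allVecs (true ∷ false ∷ []) q) n)

sizeX : {m n q : ℕ} → SubsetX m n q → ℕ
sizeX (bs , a) = foldr _ (λ b r → countTrue b + r) 0 bs + countTrue a

-- (n+k)-inset: an (n+k)-element subset of X meeting every main block.
isInsetᵇ : (m n k q : ℕ) → SubsetX m n q → Bool
isInsetᵇ m n k q (bs , a) =
  (sizeX {m} {n} {q} (bs , a) ≡ᵇ (n + k)) ∧ allᵇ nonemptyᵇ bs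

-- insetCount m n k q  =  binom{m,n}{k,q}, the number of (n+k)-insets.
insetCount : (m n k q : ℕ) → ℕ
insetCount m n k q = length (filterᵇ (isInsetᵇ m n k q) (allSubsetsX m n q))

absSum : {n : ℕ} → Vec ℤ n → ℕ
absSum = foldr _ (λ x r → ∣ x ∣ + r) 0

-- Both sides are counted by one recursion. An inset meets a main block {u, v} in both points or in
-- one of them (two ways); a lattice point has first coordinate 0, +(a+1) or -(a+1). Writing
-- insets₂ m n t for the number of t-element insets, the ball |x| ≤ m in ℤⁿ has insets₂ m n (2n)
-- points and the set of pairs (a, x) with a + 1 + |x| ≤ m has insets₂ m n (2n+1) elements: in n
-- both follow the block recursion, in m both follow Pascal's rule (the first element of the
-- additional block is taken or not, according as a = 0 or not). On the sphere |x| = m + 1 a first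
-- coordinate ±(a+1) leaves a point of the ball of radius m, giving the second count.
module Submission where

open import Defs
open import Data.Bool using (Bool; true; false; _∧_)
open import Data.Bool.Properties using (∧-identityʳ; ∧-zeroʳ)
open import Data.Empty using (⊥-elim)
open import Data.Fin using (Fin)
open import Data.Fin.Properties using (+↔⊎)
open import Data.Integer using (ℤ; +0; +[1+_]; -[1+_])
open import Data.List using (List; []; _∷_; _++_; concatMap; map; length; filterᵇ)
open import Data.List.Properties
  using (filter-++; length-++; concatMap-++; concatMap-cong; concatMap-map; map-concatMap; map-∘)
open import Data.Nat using (ℕ; zero; suc; _+_; _*_; _∸_; _≡ᵇ_; _≤_; _<_; z≤n; s≤s; s≤s⁻¹)
open import Data.Nat.Combinatorics using (_C_; nCk+nC[k+1]≡[n+1]C[k+1])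
open import Data.Nat.Combinatorics.Specification using (k>n⇒nCk≡0)
open import Data.Nat.ListAction using (sum)
open import Data.Nat.Properties
  using (+-suc; +-identityʳ; suc-injective; ≤-irrelevant; ≡-irrelevant; ≤-trans; ≤-reflexive;
         m≤n+m; m∸n+n≡m; m+n∸n≡m; m<n⇒m<1+n)
open import Data.Nat.Tactic.RingSolver using (solve-∀)
open import Data.Product using (Σ; _×_; _,_; proj₁)
open import Data.Sum using (_⊎_; inj₁; inj₂)
open import Data.Sum.Function.Propositional using (_⊎-↔_)
open import Data.Vec using (Vec; []; _∷_)
open import Function using (_∘_)
open import Function.Bundles using (_↔_; mk↔ₛ′)
open import Function.Properties.Inverse using (↔-sym; ↔-trans)
open import Relation.Binary.PropositionalEquality
  using (_≡_; refl; sym; trans; cong; cong₂; subst; _≗_; module ≡-Reasoning)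
open import Relation.Nullary using (¬_)

private variable
  A B : Set
  a b : ℕ

count : (A → Bool) → List A → ℕ
count p = length ∘ filterᵇ p

count-++ : (p : A → Bool) (xs ys : List A) → count p (xs ++ ys) ≡ count p xs + count p ys
count-++ p xs ys = trans (cong length (filter-++ _ xs ys)) (length-++ (filterᵇ p xs))

count-map : (p : B → Bool) (f : A → B) (xs : List A) → count p (map f xs) ≡ count (p ∘ f) xs
count-map p f [] = refl
count-map p f (x ∷ xs) with p (f x)
... | true  = cong suc (count-map p f xs)
... | false = count-map p f xs

count-cong : {p q : A → Bool} → p ≗ q → (xs : List A) → count p xs ≡ count q xs
count-cong p≗q [] = refl
count-cong {p = p} {q} p≗q (x ∷ xs) with p x | q x | p≗q x
... | true  | true  | refl = cong suc (count-cong p≗q xs)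
... | false | false | refl = count-cong p≗q xs

count-none : {p : A → Bool} → (∀ x → p x ≡ false) → (xs : List A) → count p xs ≡ 0
count-none none xs = trans (count-cong none xs) (falses xs)
  where
  falses : (xs : List _) → count (λ _ → false) xs ≡ 0
  falses []       = refl
  falses (_ ∷ xs) = falses xs

count-concatMap-map : {C : Set} (p : C → Bool) (f : A → B → C) (ys : List B) (xs : List A) →
  count p (concatMap (λ x → map (f x) ys) xs) ≡ sum (map (λ x → count (p ∘ f x) ys) xs)
count-concatMap-map p f ys [] = refl
count-concatMap-map p f ys (x ∷ xs) = begin
  count p (map (f x) ys ++ concatMap (λ x → map (f x) ys) xs)
    ≡⟨ count-++ p (map (f x) ys) _ ⟩
  count p (map (f x) ys) + count p (concatMap (λ x → map (f x) ys) xs)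
    ≡⟨ cong₂ _+_ (count-map p (f x) ys) (count-concatMap-map p f ys xs) ⟩
  count (p ∘ f x) ys + sum (map (λ x → count (p ∘ f x) ys) xs) ∎
  where open ≡-Reasoning

delay : (ℕ → ℕ) → ℕ → ℕ
delay f zero    = 0
delay f (suc t) = f t

delay-cong : {f g : ℕ → ℕ} → f ≗ g → delay f ≗ delay g
delay-cong f≗g zero    = refl
delay-cong f≗g (suc t) = f≗g t

module _ (g : A → ℕ) (h : A → Bool) (xs : List A) where

  countOfSize : ℕ → ℕ
  countOfSize t = count (λ x → (g x ≡ᵇ t) ∧ h x) xs

  count-suc-≡ᵇ : ∀ t → count (λ x → (suc (g x) ≡ᵇ t) ∧ h x) xs ≡ delay countOfSize t
  count-suc-≡ᵇ zero    = count-none (λ _ → refl) xs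
  count-suc-≡ᵇ (suc t) = refl

  count-2+-≡ᵇ : ∀ t → count (λ x → (suc (suc (g x)) ≡ᵇ t) ∧ h x) xs ≡ delay (delay countOfSize) t
  count-2+-≡ᵇ zero    = count-none (λ _ → refl) xs
  count-2+-≡ᵇ (suc t) = count-suc-≡ᵇ t

bits : List Bool
bits = true ∷ false ∷ []

C-pascal : ∀ m t → suc m C t ≡ delay (m C_) t + m C t
C-pascal m zero    = refl
C-pascal m (suc t) = sym (nCk+nC[k+1]≡[n+1]C[k+1] m t)

count-subsets : ∀ m t → count (λ a → countTrue a ≡ᵇ t) (allVecs bits m) ≡ m C t
count-subsets zero zero    = refl
count-subsets zero (suc t) = refl
count-subsets (suc m) t = begin
  count p (allVecs bits (suc m))
    ≡⟨ count-concatMap-map p _∷_ (allVecs bits m) bits ⟩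
  count (p ∘ (true ∷_)) (allVecs bits m) + (count (p ∘ (false ∷_)) (allVecs bits m) + 0)
    ≡⟨ cong₂ _+_ (ones t) (+-identityʳ _) ⟩
  delay (m C_) t + count p (allVecs bits m)
    ≡⟨ cong (delay (m C_) t +_) (count-subsets m t) ⟩
  delay (m C_) t + m C t
    ≡⟨ C-pascal m t ⟨
  suc m C t ∎
  where
  open ≡-Reasoning
  p : ∀ {k} → Vec Bool k → Bool
  p a = countTrue a ≡ᵇ t
  ones : ∀ t → count (λ a → suc (countTrue a) ≡ᵇ t) (allVecs bits m) ≡ delay (m C_) t
  ones zero    = count-none (λ _ → refl) (allVecs bits m)
  ones (suc t) = count-subsets m t

insets₂ : ℕ → ℕ → ℕ → ℕ
insets₂ m zero    t = m C t
insets₂ m (suc n) t = delay (delay (insets₂ m n)) t + 2 * delay (insets₂ m n) t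

insets₂-pascal : ∀ m n t → insets₂ (suc m) n t ≡ delay (insets₂ m n) t + insets₂ m n t
insets₂-pascal m zero    t                   = C-pascal m t
insets₂-pascal m (suc n) zero                = refl
insets₂-pascal m (suc n) (suc zero)          = cong (2 *_) (insets₂-pascal m n 0)
insets₂-pascal m (suc n) (suc (suc t)) = begin
  f′ t + 2 * f′ (suc t)
    ≡⟨ cong₂ (λ x y → x + 2 * y) (insets₂-pascal m n t) (insets₂-pascal m n (suc t)) ⟩
  (delay f t + f t) + 2 * (f t + f (suc t))
    ≡⟨ regroup (delay f t) (f t) (f (suc t)) ⟩
  (delay f t + 2 * f t) + (f t + 2 * f (suc t)) ∎
  where
  open ≡-Reasoning
  f f′ : ℕ → ℕ
  f  = insets₂ m n
  f′ = insets₂ (suc m) n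
  regroup : ∀ x y z → (x + y) + 2 * (y + z) ≡ (x + 2 * y) + (y + 2 * z)
  regroup = solve-∀

insets₂-beyond : ∀ m n t → n + n + m < t → insets₂ m n t ≡ 0
insets₂-beyond m zero    t             m<t = k>n⇒nCk≡0 m<t
insets₂-beyond m (suc n) (suc zero)    (s≤s ())
insets₂-beyond m (suc n) (suc (suc t)) 2n+2+m<t+2 =
  cong₂ (λ x y → x + 2 * y)
    (insets₂-beyond m n t 2n+m<t) (insets₂-beyond m n (suc t) (m<n⇒m<1+n 2n+m<t))
  where
  2n+m<t : n + n + m < t
  2n+m<t = s≤s⁻¹ (s≤s⁻¹ (subst (_< suc (suc t)) (cong (λ k → suc k + m) (+-suc n n)) 2n+2+m<t+2))

concatMap-concatMap : {C : Set} (f : B → List C) (g : A → List B) (xs : List A) →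
  concatMap f (concatMap g xs) ≡ concatMap (concatMap f ∘ g) xs
concatMap-concatMap f g []       = refl
concatMap-concatMap f g (x ∷ xs) =
  trans (concatMap-++ f (g x) (concatMap g xs)) (cong (concatMap f (g x) ++_) (concatMap-concatMap f g xs))

addBlock : ∀ {m n q} → Vec Bool q → SubsetX m n q → SubsetX m (suc n) q
addBlock b (bs , a) = (b ∷ bs , a)

allSubsetsX-suc : ∀ m n q →
  allSubsetsX m (suc n) q ≡ concatMap (λ b → map (addBlock b) (allSubsetsX m n q)) (allVecs bits q)
allSubsetsX-suc m n q = begin
  concatMap F (concatMap (λ b → map (b ∷_) V) (allVecs bits q))
    ≡⟨ concatMap-concatMap F (λ b → map (b ∷_) V) (allVecs bits q) ⟩
  concatMap (λ b → concatMap F (map (b ∷_) V)) (allVecs bits q)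
    ≡⟨ concatMap-cong (λ b → block b) (allVecs bits q) ⟩
  concatMap (λ b → map (addBlock b) (concatMap F V)) (allVecs bits q) ∎
  where
  open ≡-Reasoning
  V : List (Vec (Vec Bool q) n)
  V = allVecs (allVecs bits q) n
  F : ∀ {k} → Vec (Vec Bool q) k → List (SubsetX m k q)
  F bs = map (bs ,_) (allVecs bits m)
  block : ∀ b → concatMap F (map (b ∷_) V) ≡ map (addBlock b) (concatMap F V)
  block b = begin
    concatMap F (map (b ∷_) V)                   ≡⟨ concatMap-map F (b ∷_) V ⟩
    concatMap (λ bs → map ((b ∷ bs) ,_) E) V     ≡⟨ concatMap-cong (λ bs → map-∘ E) V ⟩
    concatMap (map (addBlock b) ∘ F) V           ≡⟨ map-concatMap (addBlock b) F V ⟨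
    map (addBlock b) (concatMap F V)             ∎
    where E = allVecs bits m

isInsetOfSizeᵇ : (m n q t : ℕ) → SubsetX m n q → Bool
isInsetOfSizeᵇ m n q t (bs , a) = (sizeX {m} {n} {q} (bs , a) ≡ᵇ t) ∧ allᵇ nonemptyᵇ bs

count-insets : ∀ m n t → count (isInsetOfSizeᵇ m n 2 t) (allSubsetsX m n 2) ≡ insets₂ m n t
count-insets m zero t = begin
  count (isInsetOfSizeᵇ m 0 2 t) (map ([] ,_) E ++ [])
    ≡⟨ count-concatMap-map (isInsetOfSizeᵇ m 0 2 t) _,_ E ([] ∷ []) ⟩
  count (λ a → (countTrue a ≡ᵇ t) ∧ true) E + 0
    ≡⟨ +-identityʳ _ ⟩
  count (λ a → (countTrue a ≡ᵇ t) ∧ true) E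
    ≡⟨ count-cong (λ a → ∧-identityʳ (countTrue a ≡ᵇ t)) E ⟩
  count (λ a → countTrue a ≡ᵇ t) E
    ≡⟨ count-subsets m t ⟩
  m C t ∎
  where
  open ≡-Reasoning
  E = allVecs bits m
count-insets m (suc n) t = begin
  count p (allSubsetsX m (suc n) 2)
    ≡⟨ cong (count p) (allSubsetsX-suc m n 2) ⟩
  count p (concatMap (λ b → map (addBlock b) S) (allVecs bits 2))
    ≡⟨ count-concatMap-map p addBlock S (allVecs bits 2) ⟩
  count (p ∘ addBlock (true ∷ true ∷ [])) S + (count (p ∘ addBlock (true ∷ false ∷ [])) S
    + (count (p ∘ addBlock (false ∷ true ∷ [])) S + (count (p ∘ addBlock (false ∷ false ∷ [])) S + 0)))
    ≡⟨ cong₂ _+_ both (cong₂ _+_ one (cong₂ _+_ one (cong (_+ 0) neither))) ⟩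
  delay (delay (insets₂ m n)) t + 2 * delay (insets₂ m n) t ∎
  where
  open ≡-Reasoning
  p : SubsetX m (suc n) 2 → Bool
  p = isInsetOfSizeᵇ m (suc n) 2 t
  S : List (SubsetX m n 2)
  S = allSubsetsX m n 2
  allBlocksMet : SubsetX m n 2 → Bool
  allBlocksMet = allᵇ nonemptyᵇ ∘ proj₁
  both : count (λ x → (suc (suc (sizeX x)) ≡ᵇ t) ∧ allBlocksMet x) S ≡ delay (delay (insets₂ m n)) t
  both = trans (count-2+-≡ᵇ sizeX allBlocksMet S t) (delay-cong (delay-cong (count-insets m n)) t)
  one : count (λ x → (suc (sizeX x) ≡ᵇ t) ∧ allBlocksMet x) S ≡ delay (insets₂ m n) t
  one = trans (count-suc-≡ᵇ sizeX allBlocksMet S t) (delay-cong (count-insets m n) t)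
  neither : count (λ x → (sizeX x ≡ᵇ t) ∧ false) S ≡ 0
  neither = count-none (λ _ → ∧-zeroʳ _) S

Points : (ℕ → Set) → ℕ → Set
Points P n = Σ (Vec ℤ n) (λ x → P (absSum x))

PositiveHead : (ℕ → Set) → ℕ → Set
PositiveHead P n = Σ ℕ (λ a → Points (λ s → P (suc a + s)) n)

points-suc : (P : ℕ → Set) (n : ℕ) →
  Points P (suc n) ↔ (Points P n ⊎ (PositiveHead P n ⊎ PositiveHead P n))
points-suc P n = mk↔ₛ′ to from
  (λ { (inj₁ _) → refl ; (inj₂ (inj₁ _)) → refl ; (inj₂ (inj₂ _)) → refl })
  (λ { (+0 ∷ _ , _) → refl ; (+[1+ _ ] ∷ _ , _) → refl ; (-[1+ _ ] ∷ _ , _) → refl })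
  where
  to : Points P (suc n) → Points P n ⊎ (PositiveHead P n ⊎ PositiveHead P n)
  to (+0       ∷ x , p) = inj₁ (x , p)
  to (+[1+ a ] ∷ x , p) = inj₂ (inj₁ (a , x , p))
  to (-[1+ a ] ∷ x , p) = inj₂ (inj₂ (a , x , p))
  from : Points P n ⊎ (PositiveHead P n ⊎ PositiveHead P n) → Points P (suc n)
  from (inj₁ (x , p))           = +0 ∷ x , p
  from (inj₂ (inj₁ (a , x , p))) = +[1+ a ] ∷ x , p
  from (inj₂ (inj₂ (a , x , p))) = -[1+ a ] ∷ x , p

¬positiveHead-≤0 : ∀ n → ¬ PositiveHead (_≤ 0) n
¬positiveHead-≤0 n (_ , _ , ())

positiveHead-≤-suc : ∀ m n →
  PositiveHead (_≤ suc m) n ↔ (Points (_≤ m) n ⊎ PositiveHead (_≤ m) n)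
positiveHead-≤-suc m n = mk↔ₛ′ to from
  (λ { (inj₁ _) → refl ; (inj₂ _) → refl })
  (λ { (zero , _ , s≤s _) → refl ; (suc _ , _ , s≤s _) → refl })
  where
  to : PositiveHead (_≤ suc m) n → Points (_≤ m) n ⊎ PositiveHead (_≤ m) n
  to (zero  , x , s≤s p) = inj₁ (x , p)
  to (suc a , x , s≤s p) = inj₂ (a , x , p)
  from : Points (_≤ m) n ⊎ PositiveHead (_≤ m) n → PositiveHead (_≤ suc m) n
  from (inj₁ (x , p))     = zero  , x , s≤s p
  from (inj₂ (a , x , p)) = suc a , x , s≤s p

positiveHead-≡-suc : ∀ m n → PositiveHead (_≡ suc m) n ↔ Points (_≤ m) n
positiveHead-≡-suc m n = mk↔ₛ′ to from
  (λ { (x , _) → cong (x ,_) (≤-irrelevant _ _) })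
  (λ { (a , x , p) →
       head-≡ (trans (cong (_∸ absSum x) (sym (suc-injective p))) (m+n∸n≡m a (absSum x))) })
  where
  to : PositiveHead (_≡ suc m) n → Points (_≤ m) n
  to (a , x , p) = x , ≤-trans (m≤n+m (absSum x) a) (≤-reflexive (suc-injective p))
  from : Points (_≤ m) n → PositiveHead (_≡ suc m) n
  from (x , p) = m ∸ absSum x , x , cong suc (m∸n+n≡m p)
  head-≡ : ∀ {a b x} {p : suc a + absSum x ≡ suc m} {q : suc b + absSum x ≡ suc m} →
           a ≡ b → _≡_ {A = PositiveHead (_≡ suc m) n} (a , x , p) (b , x , q)
  head-≡ {a} {x = x} refl = cong (λ r → a , x , r) (≡-irrelevant _ _)

¬sphere-dim0 : ∀ m → ¬ Points (_≡ suc m) 0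
¬sphere-dim0 m ([] , ())

ball-dim0 : ∀ m → Points (_≤ m) 0 ↔ Fin 1
ball-dim0 m = mk↔ₛ′ (λ _ → Fin.zero) (λ _ → [] , z≤n)
  (λ { Fin.zero → refl ; (Fin.suc ()) }) (λ { ([] , z≤n) → refl })
  where import Data.Fin as Fin

cast-↔Fin : a ≡ b → A ↔ Fin a → A ↔ Fin b
cast-↔Fin refl f = f

empty↔Fin0 : ¬ A → A ↔ Fin 0
empty↔Fin0 ¬a = mk↔ₛ′ (λ x → ⊥-elim (¬a x)) (λ ()) (λ ()) (λ x → ⊥-elim (¬a x))

_⊎-Fin_ : A ↔ Fin a → B ↔ Fin b → (A ⊎ B) ↔ Fin (a + b)
f ⊎-Fin g = ↔-trans (f ⊎-↔ g) (↔-sym +↔⊎)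

doubled-Fin : A ↔ Fin a → (A ⊎ A) ↔ Fin (2 * a)
doubled-Fin {a = a} f = cast-↔Fin (cong (a +_) (sym (+-identityʳ a))) (f ⊎-Fin f)

mutual
  ball-count : ∀ n m → Points (_≤ m) n ↔ Fin (insets₂ m n (n + n))
  ball-count zero    m = ball-dim0 m
  ball-count (suc n) m =
    cast-↔Fin (cong (insets₂ m (suc n) ∘ suc) (sym (+-suc n n)))
      (↔-trans (points-suc (_≤ m) n) (ball-count n m ⊎-Fin doubled-Fin (positiveHead-count n m)))

  positiveHead-count : ∀ n m → PositiveHead (_≤ m) n ↔ Fin (insets₂ m n (suc (n + n)))
  positiveHead-count n zero =
    cast-↔Fin (sym (insets₂-beyond 0 n (suc (n + n)) (s≤s (≤-reflexive (+-identityʳ (n + n))))))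
      (empty↔Fin0 (¬positiveHead-≤0 n))
  positiveHead-count n (suc m) =
    cast-↔Fin (sym (insets₂-pascal m n (suc (n + n))))
      (↔-trans (positiveHead-≤-suc m n) (ball-count n m ⊎-Fin positiveHead-count n m))

sphere-count : ∀ n m → Points (_≡ suc m) n ↔ Fin (delay (insets₂ m n) (n + n))
sphere-count zero    m = empty↔Fin0 (¬sphere-dim0 m)
sphere-count (suc n) m =
  cast-↔Fin (cong (insets₂ m (suc n)) (sym (+-suc n n)))
    (↔-trans (points-suc (_≡ suc m) n)
      (sphere-count n m ⊎-Fin doubled-Fin (↔-trans (positiveHead-≡-suc m n) (ball-count n m))))

mainTheorem11 : (m n : ℕ) → 1 ≤ n →
    ((Σ (Vec ℤ n) (λ x → absSum x ≤ m)) ↔ Fin (insetCount m n n 2))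
    × (1 ≤ m → (Σ (Vec ℤ n) (λ x → absSum x ≡ m)) ↔ Fin (insetCount (m ∸ 1) n (n ∸ 1) 2))
mainTheorem11 m (suc n) _ = ball , sphere
  where
  ball : Points (_≤ m) (suc n) ↔ Fin (insetCount m (suc n) (suc n) 2)
  ball = cast-↔Fin (sym (count-insets m (suc n) (suc n + suc n))) (ball-count (suc n) m)
  sphere : 1 ≤ m → Points (_≡ m) (suc n) ↔ Fin (insetCount (m ∸ 1) (suc n) n 2)
  sphere (s≤s {n = m′} _) =
    cast-↔Fin (trans (cong (insets₂ m′ (suc n)) (+-suc n n)) (sym (count-insets m′ (suc n) (suc n + n))))
      (sphere-count (suc n) m′)
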